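{- Consider $2\times2\times2$ arrays with entries in $\{0,1\}$, with rank computed over the non-negative integers. The maximum rank is $4$, and the numbers of arrays of rank $0,1,2,3,4$ are $1,27,130,88,10$; moreover, for every $2\times2\times2$ $\{0,1\}$-array, its rank over the non-negative integers equals its Boolean rank. Consequently every $2\times2\times2$ Boolean array of Boolean rank $r$ can be written as a sum of $r$ outer products of nonzero $\{0,1\}$-vectors no two of which have an entry $1$ in the same position.
   Context: For $\{0,1\}$-vectors $V_1,V_2,V_3$ of length 2, $V_1\otimes V_2\otimes V_3$ has entries $v_{1i}v_{2j}v_{3k}$. The integer rank of a $\{0,1\}$-array $X$ is the least $R$ such that $X$ equals the ordinary integer sum of $R$ outer products of nonzero $\{0,1\}$-vectors (so no two terms have a $1$ in the same position). The Boolean rank is defined the same way but with entrywise Boolean addition $1+1=1$. -}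

module Defs where

open import Data.Bool using (Bool; true; false; _∧_; _∨_; if_then_else_)
open import Data.Nat using (ℕ; zero; suc; _+_; _*_; _≤_)
open import Data.Fin using (Fin)
open import Data.Vec using (Vec; []; _∷_; lookup)
open import Data.List using (List; length)
open import Data.List.Membership.Propositional using (_∈_)
open import Data.List.Relation.Unary.Unique.Propositional using (Unique)
open import Data.Product using (Σ; _×_; _,_)
open import Relation.Binary.PropositionalEquality using (_≡_; _≢_)
open import Function.Bundles using (_⇔_)

-- {0,1}-vectors of length 2 (false = 0, true = 1)
BVec : Set
BVec = Vec Bool 2

Array : Set
Array = Vec (Vec (Vec Bool 2) 2) 2

entry : Array → Fin 2 → Fin 2 → Fin 2 → Bool
entry X i j k = lookup (lookup (lookup X i) j) k

NonZeroVec : BVec → Set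
NonZeroVec v = v ≢ (false ∷ false ∷ [])

-- an outer product V1 ⊗ V2 ⊗ V3 of nonzero {0,1}-vectors
record Term : Set where
  constructor term
  field
    v₁ v₂ v₃ : BVec
    nz₁ : NonZeroVec v₁
    nz₂ : NonZeroVec v₂
    nz₃ : NonZeroVec v₃

termEntry : Term → Fin 2 → Fin 2 → Fin 2 → Bool
termEntry (term a b c _ _ _) i j k = lookup a i ∧ lookup b j ∧ lookup c k

toℕ𝔹 : Bool → ℕ
toℕ𝔹 b = if b then 1 else 0

intSum : ∀ {R} → Vec Term R → Fin 2 → Fin 2 → Fin 2 → ℕ
intSum [] i j k = 0
intSum (t ∷ ts) i j k = toℕ𝔹 (termEntry t i j k) + intSum ts i j k

boolSum : ∀ {R} → Vec Term R → Fin 2 → Fin 2 → Fin 2 → Bool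
boolSum [] i j k = false
boolSum (t ∷ ts) i j k = termEntry t i j k ∨ boolSum ts i j k

IntDecomp : Array → ℕ → Set
IntDecomp X R = Σ (Vec Term R) λ ts →
  ∀ i j k → intSum ts i j k ≡ toℕ𝔹 (entry X i j k)

BoolDecomp : Array → ℕ → Set
BoolDecomp X R = Σ (Vec Term R) λ ts →
  ∀ i j k → boolSum ts i j k ≡ entry X i j k

IntRank : Array → ℕ → Set
IntRank X r = IntDecomp X r × (∀ R → IntDecomp X R → r ≤ R)

BoolRank : Array → ℕ → Set
BoolRank X r = BoolDecomp X r × (∀ R → BoolDecomp X R → r ≤ R)

HasCount : (Array → Set) → ℕ → Set
HasCount P n = Σ (List Array) λ xs →
  Unique xs × length xs ≡ n × (∀ X → (X ∈ xs) ⇔ P X)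

module Submission where

-- The rank of a 2×2×2 {0,1}-array is determined by exhaustive, but
-- verified, computation.  A subset of the 8 cells is a Boolean vector of
-- length 8, and every term V₁ ⊗ V₂ ⊗ V₃ has one of 27 "shapes".
--
-- An exhaustive search `covers` decides whether a
--    Boolean vector is a union of R members of a list; it is proved
--    complete for any list of subsets of any finite set.  The computed rank
--    ρ X is the least R < 4 for which the support of X is a union of R
--    shapes lying inside it (or 4).  Completeness gives ρ X ≤ R for every
--    Boolean decomposition with R terms, hence also for every integer
--    decomposition, which is in particular a Boolean one.
--  * Upper bound.  An untrusted search proposes, for each of the 256
--    arrays, ρ X pairwise disjoint terms; a decision procedure checks that
--    their integer sum is X.
--
-- So ρ X is both the integer and the Boolean rank of every X.  The counts
-- are lengths of the filtered list of all arrays, and the theorem follows.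

open import Defs
open import Data.Nat using (ℕ; _≤_)
open import Data.Product using (Σ; _×_)
open import Relation.Binary.PropositionalEquality using (_≡_)
open import Function.Bundles using (_⇔_)

open import Data.Nat using (zero; suc; z≤n; s≤s; _<ᵇ_; _≟_)
open import Data.Nat.Properties using (≤-antisym)
open import Data.Bool using (Bool; true; false; _∧_; _∨_; not; if_then_else_; T)
import Data.Bool.Properties as Boolₚ
open import Data.Fin using (Fin)
import Data.Fin as Fin
open import Data.Fin.Properties using (all?)
open import Data.Vec using (Vec; []; _∷_; zipWith; replicate; foldr′)
import Data.Vec as Vec
import Data.Vec.Properties as Vecₚ
open import Data.Vec.Relation.Unary.All using (All; []; _∷_; universal)
import Data.Vec.Relation.Unary.All as VecAll
import Data.Vec.Relation.Unary.All.Properties as VecAllₚ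
open import Data.List using (List; []; _∷_; length; filter; cartesianProduct; cartesianProductWith)
open import Data.Bool.ListAction using (any)
import Data.List as List
open import Data.List.Membership.Propositional using (_∈_; lose)
open import Data.List.Membership.Propositional.Properties
  using (∈-map⁺; ∈-cartesianProductWith⁺; ∈-cartesianProduct⁺; ∈-filter⁺; ∈-filter⁻)
open import Data.List.Relation.Unary.Any using (here; there)
import Data.List.Relation.Unary.All as ListAll
open import Data.List.Relation.Unary.Any.Properties using (any⁺)
open import Data.List.Relation.Unary.All.Properties using (all⁺)
open import Data.List.Relation.Unary.Unique.Propositional using (Unique)
import Data.List.Relation.Unary.Unique.Propositional.Properties as Uniqueₚ
import Data.List.Relation.Unary.AllPairs as AllPairs
open import Data.Maybe using (Maybe; just; nothing; _<∣>_)
import Data.Maybe as Maybe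
open import Data.Product using (_,_; proj₂; ∃)
open import Relation.Binary.PropositionalEquality
  using (refl; sym; trans; cong; subst; module ≡-Reasoning)
open import Relation.Nullary using (Dec)
open import Relation.Nullary.Decidable using (isYes; toWitness; fromWitness)
open import Function.Base using (_∘_)
open import Data.Empty using (⊥-elim)
open import Function.Bundles using (mk⇔)

pattern 𝟘 = Fin.zero
pattern 𝟙 = Fin.suc Fin.zero

flatten : {A : Set} → (Fin 2 → Fin 2 → Fin 2 → A) → Vec A 8
flatten f = f 𝟘 𝟘 𝟘 ∷ f 𝟘 𝟘 𝟙 ∷ f 𝟘 𝟙 𝟘 ∷ f 𝟘 𝟙 𝟙
          ∷ f 𝟙 𝟘 𝟘 ∷ f 𝟙 𝟘 𝟙 ∷ f 𝟙 𝟙 𝟘 ∷ f 𝟙 𝟙 𝟙 ∷ []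

flatten-cong : {A : Set} (f g : Fin 2 → Fin 2 → Fin 2 → A) →
               (∀ i j k → f i j k ≡ g i j k) → flatten f ≡ flatten g
flatten-cong f g e
  rewrite e 𝟘 𝟘 𝟘 | e 𝟘 𝟘 𝟙 | e 𝟘 𝟙 𝟘 | e 𝟘 𝟙 𝟙
        | e 𝟙 𝟘 𝟘 | e 𝟙 𝟘 𝟙 | e 𝟙 𝟙 𝟘 | e 𝟙 𝟙 𝟙 = refl

support : Array → Vec Bool 8
support X = flatten (entry X)

module _ {n : ℕ} where

  infixr 6 _∪_
  infix 4 _⊆_ _⊆?_

  ∅ : Vec Bool n
  ∅ = replicate n false

  _∪_ : Vec Bool n → Vec Bool n → Vec Bool n
  _∪_ = zipWith _∨_

  _⊆_ : Vec Bool n → Vec Bool n → Set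
  s ⊆ a = s ∪ a ≡ a

  _≟ᵛ_ : (a b : Vec Bool n) → Dec (a ≡ b)
  _≟ᵛ_ = Vecₚ.≡-dec Boolₚ._≟_

  _⊆?_ : (s a : Vec Bool n) → Dec (s ⊆ a)
  s ⊆? a = (s ∪ a) ≟ᵛ a

  _∖_ : Vec Bool n → Vec Bool n → Vec Bool n
  a ∖ s = zipWith (λ x y → x ∧ not y) a s

  ∪-assoc : ∀ a b c → (a ∪ b) ∪ c ≡ a ∪ (b ∪ c)
  ∪-assoc = Vecₚ.zipWith-assoc Boolₚ.∨-assoc

  ∪-comm : ∀ a b → a ∪ b ≡ b ∪ a
  ∪-comm = Vecₚ.zipWith-comm Boolₚ.∨-comm

  ∪-idem : ∀ a → a ∪ a ≡ a
  ∪-idem = Vecₚ.zipWith-idem Boolₚ.∨-idem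

  ∪-identityʳ : ∀ a → a ∪ ∅ ≡ a
  ∪-identityʳ = Vecₚ.zipWith-identityʳ Boolₚ.∨-identityʳ

  ∪-identityˡ : ∀ a → ∅ ∪ a ≡ a
  ∪-identityˡ = Vecₚ.zipWith-identityˡ Boolₚ.∨-identityˡ

  ⋃ : ∀ {R} → Vec (Vec Bool n) R → Vec Bool n
  ⋃ = foldr′ _∪_ ∅

  ∪-shift : ∀ a s b → (s ∪ a) ∪ b ≡ a ∪ (s ∪ b)
  ∪-shift a s b = begin
    (s ∪ a) ∪ b   ≡⟨ cong (_∪ b) (∪-comm s a) ⟩
    (a ∪ s) ∪ b   ≡⟨ ∪-assoc a s b ⟩
    a ∪ (s ∪ b)   ∎
    where open ≡-Reasoning

  ⊆-∪ˡ : ∀ s b → s ⊆ s ∪ b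
  ⊆-∪ˡ s b = begin
    s ∪ (s ∪ b)   ≡⟨ sym (∪-assoc s s b) ⟩
    (s ∪ s) ∪ b   ≡⟨ cong (_∪ b) (∪-idem s) ⟩
    s ∪ b         ∎
    where open ≡-Reasoning

  ⊆-∪ʳ : ∀ {s b} a → s ⊆ b → s ⊆ a ∪ b
  ⊆-∪ʳ {s} {b} a s⊆b = begin
    s ∪ (a ∪ b)   ≡⟨ sym (∪-assoc s a b) ⟩
    (s ∪ a) ∪ b   ≡⟨ ∪-shift a s b ⟩
    a ∪ (s ∪ b)   ≡⟨ cong (a ∪_) s⊆b ⟩
    a ∪ b         ∎
    where open ≡-Reasoning

  ⋃-upper : ∀ {R} (ss : Vec (Vec Bool n) R) → All (_⊆ ⋃ ss) ss
  ⋃-upper []       = []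
  ⋃-upper (s ∷ ss) = ⊆-∪ˡ s (⋃ ss) ∷ VecAll.map (⊆-∪ʳ s) (⋃-upper ss)

  covers : List (Vec Bool n) → ℕ → (a acc : Vec Bool n) → Bool
  covers S zero    a acc = isYes (acc ≟ᵛ a)
  covers S (suc R) a acc = any (λ s → covers S R a (s ∪ acc)) S

  covers-complete : ∀ S {R} (ss : Vec (Vec Bool n) R) (a acc : Vec Bool n) →
                    All (_∈ S) ss → acc ∪ ⋃ ss ≡ a → T (covers S R a acc)
  covers-complete S [] a acc [] eq = fromWitness (trans (sym (∪-identityʳ acc)) eq)
  covers-complete S {suc R} (s ∷ ss) a acc (s∈S ∷ ss∈S) eq =
    any⁺ (λ s → covers S R a (s ∪ acc))
      (lose s∈S (covers-complete S ss a (s ∪ acc) ss∈S (trans (∪-shift acc s (⋃ ss)) eq)))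

-- the least k < n with p k, or n if there is none
leastBelow : (ℕ → Bool) → ℕ → ℕ
leastBelow p zero    = zero
leastBelow p (suc n) = if p zero then zero else suc (leastBelow (p ∘ suc) n)

leastBelow-bound : ∀ p n → leastBelow p n ≤ n
leastBelow-bound p zero = z≤n
leastBelow-bound p (suc n) with p zero
... | true  = z≤n
... | false = s≤s (leastBelow-bound (p ∘ suc) n)

leastBelow-minimal : ∀ p n k → T (p k) → leastBelow p n ≤ k
leastBelow-minimal p zero    k       pk = z≤n
leastBelow-minimal p (suc n) k       pk with p zero in eq
leastBelow-minimal p (suc n) k       pk | true  = z≤n
leastBelow-minimal p (suc n) zero    pk | false rewrite eq = ⊥-elim pk
leastBelow-minimal p (suc n) (suc k) pk | false = s≤s (leastBelow-minimal (p ∘ suc) n k pk)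

nonzeroVecs : List (Σ BVec NonZeroVec)
nonzeroVecs = ((true ∷ false ∷ []) , λ ()) ∷ ((false ∷ true ∷ []) , λ ())
            ∷ ((true ∷ true ∷ []) , λ ()) ∷ []

nonzeroVecs-complete : ∀ v → NonZeroVec v → ∃ λ nz → (v , nz) ∈ nonzeroVecs
nonzeroVecs-complete (false ∷ false ∷ []) nz = ⊥-elim (nz refl)
nonzeroVecs-complete (true ∷ false ∷ [])  nz = _ , here refl
nonzeroVecs-complete (false ∷ true ∷ [])  nz = _ , there (here refl)
nonzeroVecs-complete (true ∷ true ∷ [])   nz = _ , there (there (here refl))

mkTerm : Σ BVec NonZeroVec → Σ BVec NonZeroVec × Σ BVec NonZeroVec → Term
mkTerm (a , nza) ((b , nzb) , (c , nzc)) = term a b c nza nzb nzc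

allTerms : List Term
allTerms = cartesianProductWith mkTerm nonzeroVecs (cartesianProduct nonzeroVecs nonzeroVecs)

shapeOf : Term → Vec Bool 8
shapeOf t = flatten (termEntry t)

shapes : List (Vec Bool 8)
shapes = List.map shapeOf allTerms

-- a shape depends only on the vectors, so every term's shape is listed
shapeOf-∈ : ∀ t → shapeOf t ∈ shapes
shapeOf-∈ (term a b c nza nzb nzc)
  with _ , a∈ ← nonzeroVecs-complete a nza
     | _ , b∈ ← nonzeroVecs-complete b nzb
     | _ , c∈ ← nonzeroVecs-complete c nzc
  = ∈-map⁺ shapeOf (∈-cartesianProductWith⁺ mkTerm a∈ (∈-cartesianProduct⁺ b∈ c∈))

boolSum-support : ∀ {R} (ts : Vec Term R) → flatten (boolSum ts) ≡ ⋃ (Vec.map shapeOf ts)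
boolSum-support []       = refl
boolSum-support (t ∷ ts) = cong (shapeOf t ∪_) (boolSum-support ts)

shapesIn : Array → List (Vec Bool 8)
shapesIn X = filter (_⊆? support X) shapes

-- the support of X is a union of R shapes; restricting to the shapes
-- inside X keeps the search small
coverable : Array → ℕ → Bool
coverable X R = covers (shapesIn X) R (support X) ∅

ρ : Array → ℕ
ρ X = leastBelow (coverable X) 4

ρ≤4 : ∀ X → ρ X ≤ 4
ρ≤4 X = leastBelow-bound (coverable X) 4

-- lower bound for the Boolean rank, by completeness of the search
boolLower : ∀ X R → BoolDecomp X R → ρ X ≤ R
boolLower X R (ts , sum≡X) = leastBelow-minimal (coverable X) 4 R
  (covers-complete (shapesIn X) family (support X) ∅ family⊆shapesIn union≡X)
  where
  family : Vec (Vec Bool 8) R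
  family = Vec.map shapeOf ts

  ⋃family≡X : ⋃ family ≡ support X
  ⋃family≡X = trans (sym (boolSum-support ts)) (flatten-cong _ _ sum≡X)

  union≡X : ∅ ∪ ⋃ family ≡ support X
  union≡X = trans (∪-identityˡ _) ⋃family≡X

  family⊆shapesIn : All (_∈ shapesIn X) family
  family⊆shapesIn = VecAll.map inShapesIn
    (VecAll.zip (VecAllₚ.map⁺ (universal shapeOf-∈ ts) , ⋃-upper family))
    where
    inShapesIn : ∀ {s} → s ∈ shapes × s ⊆ ⋃ family → s ∈ shapesIn X
    inShapesIn {s} (s∈shapes , s⊆⋃) =
      ∈-filter⁺ (_⊆? support X) {xs = shapes} s∈shapes (subst (s ⊆_) ⋃family≡X s⊆⋃)

boolSum-positive : ∀ {R} (ts : Vec Term R) i j k → boolSum ts i j k ≡ (0 <ᵇ intSum ts i j k)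
boolSum-positive []       i j k = refl
boolSum-positive (t ∷ ts) i j k with termEntry t i j k
... | true  = refl
... | false = boolSum-positive ts i j k

int⇒bool : ∀ X R → IntDecomp X R → BoolDecomp X R
int⇒bool X R (ts , sum≡X) = ts , λ i j k →
  trans (boolSum-positive ts i j k) (trans (cong (0 <ᵇ_) (sum≡X i j k)) (positive-toℕ (entry X i j k)))
  where
  positive-toℕ : ∀ b → (0 <ᵇ toℕ𝔹 b) ≡ b
  positive-toℕ true  = refl
  positive-toℕ false = refl

intLower : ∀ X R → IntDecomp X R → ρ X ≤ R
intLower X R = boolLower X R ∘ int⇒bool X R

allVecs : {A : Set} → List A → (n : ℕ) → List (Vec A n)
allVecs xs zero    = [] ∷ []
allVecs xs (suc n) = cartesianProductWith _∷_ xs (allVecs xs n)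

allVecs-complete : {A : Set} {xs : List A} → (∀ x → x ∈ xs) →
                   ∀ {n} (v : Vec A n) → v ∈ allVecs xs n
allVecs-complete all∈ []      = here refl
allVecs-complete all∈ (x ∷ v) =
  ∈-cartesianProductWith⁺ _∷_ (all∈ x) (allVecs-complete all∈ v)

allVecs-unique : {A : Set} {xs : List A} → Unique xs → ∀ n → Unique (allVecs xs n)
allVecs-unique xs! zero    = ListAll.[] AllPairs.∷ AllPairs.[]
allVecs-unique xs! (suc n) =
  Uniqueₚ.cartesianProductWith⁺ _∷_ Vecₚ.∷-injective xs! (allVecs-unique xs! n)

bools : List Bool
bools = false ∷ true ∷ []

allArrays : List Array
allArrays = allVecs (allVecs (allVecs bools 2) 2) 2

allArrays-complete : ∀ X → X ∈ allArrays
allArrays-complete = allVecs-complete (allVecs-complete (allVecs-complete bool∈))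
  where
  bool∈ : ∀ b → b ∈ bools
  bool∈ false = here refl
  bool∈ true  = there (here refl)

allArrays-unique : Unique allArrays
allArrays-unique = allVecs-unique (allVecs-unique (allVecs-unique bools! 2) 2) 2
  where
  bools! : Unique bools
  bools! = ((λ ()) ListAll.∷ ListAll.[]) AllPairs.∷ ListAll.[] AllPairs.∷ AllPairs.[]

-- search for R terms with pairwise disjoint shapes partitioning a; its
-- answers are not trusted but verified by `decomposes?` below
disjointSearch : (R : ℕ) → Vec Bool 8 → Maybe (Vec Term R)
disjointSearch zero    a = if isYes (a ≟ᵛ ∅) then just [] else nothing
disjointSearch (suc R) a = List.foldr (λ t rest → extend t <∣> rest) nothing allTerms
  where
  extend : Term → Maybe (Vec Term (suc R))
  extend t = if isYes (shapeOf t ⊆? a)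
             then Maybe.map (t ∷_) (disjointSearch R (a ∖ shapeOf t))
             else nothing

decomposes? : ∀ X {R} (ts : Vec Term R) → Dec (∀ i j k → intSum ts i j k ≡ toℕ𝔹 (entry X i j k))
decomposes? X ts = all? λ i → all? λ j → all? λ k → intSum ts i j k ≟ toℕ𝔹 (entry X i j k)

verified : Array → ∀ {R} → Maybe (Vec Term R) → Bool
verified X nothing   = false
verified X (just ts) = isYes (decomposes? X ts)

verified-sound : ∀ X {R} (m : Maybe (Vec Term R)) → T (verified X m) → IntDecomp X R
verified-sound X (just ts) ok = ts , toWitness ok

-- the search yields a verified decomposition of X with ρ X terms; this is
-- decided by evaluating `all` on the 256 arrays
searchSucceeds : ∀ X → T (verified X (disjointSearch (ρ X) (support X)))
searchSucceeds X = ListAll.lookup (all⁺ succeeds allArrays _) (allArrays-complete X)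
  where
  succeeds : Array → Bool
  succeeds X = verified X (disjointSearch (ρ X) (support X))

intUpper : ∀ X → IntDecomp X (ρ X)
intUpper X = verified-sound X (disjointSearch (ρ X) (support X)) (searchSucceeds X)

least-unique : {P : ℕ → Set} {r s : ℕ} →
               P r × (∀ R → P R → r ≤ R) → P s × (∀ R → P R → s ≤ R) → r ≡ s
least-unique (pr , r-least) (ps , s-least) = ≤-antisym (r-least _ ps) (s-least _ pr)

intRank : ∀ X → IntRank X (ρ X)
intRank X = intUpper X , intLower X

boolRank : ∀ X → BoolRank X (ρ X)
boolRank X = int⇒bool X (ρ X) (intUpper X) , boolLower X

intRank-unique : ∀ X r → IntRank X r → r ≡ ρ X
intRank-unique X r rank = least-unique {P = IntDecomp X} rank (intRank X)

boolRank-unique : ∀ X r → BoolRank X r → r ≡ ρ X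
boolRank-unique X r rank = least-unique {P = BoolDecomp X} rank (boolRank X)

hasRank? : (k : ℕ) (X : Array) → Dec (ρ X ≡ k)
hasRank? k X = ρ X ≟ k

rankClass : ℕ → List Array
rankClass k = filter (hasRank? k) allArrays

rankClass-sound : ∀ k X → X ∈ rankClass k → IntRank X k
rankClass-sound k X X∈ =
  subst (IntRank X) (proj₂ (∈-filter⁻ (hasRank? k) {xs = allArrays} X∈)) (intRank X)

rankClass-complete : ∀ k X → IntRank X k → X ∈ rankClass k
rankClass-complete k X rank =
  ∈-filter⁺ (hasRank? k) (allArrays-complete X) (sym (intRank-unique X k rank))

rankClass-count : ∀ k n → length (rankClass k) ≡ n → HasCount (λ X → IntRank X k) n
rankClass-count k n len =
  rankClass k , Uniqueₚ.filter⁺ (hasRank? k) allArrays-unique , len , λ X → mk⇔ (rankClass-sound k X) (rankClass-complete k X)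

intRank⇔boolRank : ∀ X r → IntRank X r ⇔ BoolRank X r
intRank⇔boolRank X r = mk⇔
  (λ rank → subst (BoolRank X) (sym (intRank-unique X r rank)) (boolRank X))
  (λ rank → subst (IntRank X) (sym (boolRank-unique X r rank)) (intRank X))

boolRank⇒intDecomp : ∀ X r → BoolRank X r → IntDecomp X r
boolRank⇒intDecomp X r rank = subst (IntDecomp X) (sym (boolRank-unique X r rank)) (intUpper X)

X₄ : Array
X₄ = ((false ∷ true ∷ []) ∷ (true ∷ false ∷ []) ∷ [])
   ∷ ((true ∷ false ∷ []) ∷ (false ∷ true ∷ []) ∷ []) ∷ []

mainTheorem4 :
    -- maximum rank is 4: every array has an integer rank, which is ≤ 4, and rank 4 occurs
    ((X : Array) → Σ ℕ λ r → IntRank X r × r ≤ 4)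
    × Σ Array (λ X → IntRank X 4)
    -- counts of arrays of rank 0,1,2,3,4
    × HasCount (λ X → IntRank X 0) 1
    × HasCount (λ X → IntRank X 1) 27
    × HasCount (λ X → IntRank X 2) 130
    × HasCount (λ X → IntRank X 3) 88
    × HasCount (λ X → IntRank X 4) 10
    -- integer rank equals Boolean rank
    × ((X : Array) (r : ℕ) → IntRank X r ⇔ BoolRank X r)
    -- consequence: Boolean rank r ⇒ disjoint (integer) decomposition with r terms
    × ((X : Array) (r : ℕ) → BoolRank X r → IntDecomp X r)
mainTheorem4 =
    (λ X → ρ X , intRank X , ρ≤4 X)
  , (X₄ , intRank X₄)
  , rankClass-count 0 1 refl
  , rankClass-count 1 27 refl
  , rankClass-count 2 130 refl
  , rankClass-count 3 88 refl
  , rankClass-count 4 10 refl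
  , intRank⇔boolRank
  , boolRank⇒intDecomp
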